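{- Let $H$ and $G$ be graphs with $\delta=\delta(G)\geq 1$ and $n=|V(H)|$, such that $G\not\cong K_{\delta+1}$ and $H$ is not $G$-free critical. Then \[\chi_G(H)+\chi_G(\overline{H})\leq \left\lceil \frac{n}{\delta}\right\rceil+2.\]
   Context: All graphs are finite and simple. A copy of $G$ in $H$ is a subgraph of $H$ isomorphic to $G$. A $G$-free $k$-coloring of $H$ is a map $\pi:V(H)\to\{1,\dots,k\}$ such that each induced subgraph $H[\pi^{ -1}(i)]$ contains no copy of $G$; $\chi_G(H)$ is the least $k$ for which such a coloring exists. A graph $H$ with $\chi_G(H)=k$ is $G$-free critical if every proper subgraph $H'$ of $H$ satisfies $\chi_G(H')\leq k-1$. $\overline{H}$ is the complement of $H$; $K_m$ is the complete graph on $m$ vertices. -}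

module Defs where

open import Data.Nat using (ℕ; zero; suc; _+_; _∸_; _≤_; _<_)
open import Data.Nat.DivMod using (_/_)
open import Data.Fin using (Fin; _≟_)
open import Data.Bool using (Bool; true; false; not; _∧_; if_then_else_)
open import Data.Bool.Properties using (∧-zeroʳ)
open import Data.List using (List; map; allFin)
open import Data.Nat.ListAction using (sum)
open import Data.Product using (Σ; ∃; ∃-syntax; _×_; _,_)
open import Data.Sum using (_⊎_)
open import Relation.Nullary using (¬_; does; yes; no)
open import Relation.Binary.PropositionalEquality using (_≡_; refl; sym; trans; cong)
open import Function.Definitions using (Injective)

record Graph (n : ℕ) : Set where
  field
    adj    : Fin n → Fin n → Bool
    adj-sym    : ∀ u v → adj u v ≡ adj v u
    adj-irrefl : ∀ v → adj v v ≡ false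
open Graph public

neq : ∀ {n} → Fin n → Fin n → Bool
neq u v = not (does (u ≟ v))

private
  neq-sym : ∀ {n} (u v : Fin n) → neq u v ≡ neq v u
  neq-sym u v with u ≟ v | v ≟ u
  ... | yes _ | yes _ = refl
  ... | no _  | no _  = refl
  ... | yes p | no q  = Data.Empty.⊥-elim (q (sym p))
    where import Data.Empty
  ... | no p  | yes q = Data.Empty.⊥-elim (p (sym q))
    where import Data.Empty

  neq-diag : ∀ {n} (v : Fin n) → neq v v ≡ false
  neq-diag v with v ≟ v
  ... | yes _ = refl
  ... | no p  = Data.Empty.⊥-elim (p refl)
    where import Data.Empty

complement : ∀ {n} → Graph n → Graph n
complement H = record
  { adj        = λ u v → not (adj H u v) ∧ neq u v
  ; adj-sym    = λ u v → trans (cong (λ b → not b ∧ neq u v) (adj-sym H u v))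
                               (cong (not (adj H v u) ∧_) (neq-sym u v))
  ; adj-irrefl = λ v → trans (cong (not (adj H v v) ∧_) (neq-diag v)) (∧-zeroʳ _)
  }

complete : (m : ℕ) → Graph m
complete m = record
  { adj = neq ; adj-sym = neq-sym ; adj-irrefl = neq-diag }

degree : ∀ {m} → Graph m → Fin m → ℕ
degree {m} G v = sum (map (λ u → if adj G v u then 1 else 0) (allFin m))

IsMinDegree : ∀ {m} → Graph m → ℕ → Set
IsMinDegree {m} G δ = (∃[ v ] degree G v ≡ δ) × (∀ v → δ ≤ degree G v)

_≅_ : ∀ {m n} → Graph m → Graph n → Set
_≅_ {m} {n} G H =
  Σ (Fin m → Fin n) λ f → Σ (Fin n → Fin m) λ g →
    (∀ x → g (f x) ≡ x) × (∀ y → f (g y) ≡ y) ×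
    (∀ u v → adj H (f u) (f v) ≡ adj G u v)

-- An injective map Fin m → Fin n sending edges of G to edges of H:
-- its image together with the image edges is a copy of G in H.
Copy : ∀ {m n} → Graph m → Graph n → (Fin m → Fin n) → Set
Copy {m} {n} G H f =
  Injective _≡_ _≡_ f × (∀ u v → adj G u v ≡ true → adj H (f u) (f v) ≡ true)

IsGFreeColoring : ∀ {m n} (G : Graph m) (H : Graph n) (k : ℕ) →
                  (Fin n → Fin k) → Set
IsGFreeColoring {m} {n} G H k π =
  ∀ (i : Fin k) (f : Fin m → Fin n) → Copy G H f → ¬ (∀ x → π (f x) ≡ i)

HasGFreeColoring : ∀ {m n} → Graph m → Graph n → ℕ → Set
HasGFreeColoring G H k = ∃[ π ] IsGFreeColoring G H k π

IsChiG : ∀ {m n} → Graph m → Graph n → ℕ → Set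
IsChiG G H k = HasGFreeColoring G H k × (∀ j → HasGFreeColoring G H j → k ≤ j)

-- A subgraph of H, given (up to relabelling) as a graph H' on Fin p with
-- an injective map e : Fin p → Fin n that sends edges to edges.
IsProperSubgraph : ∀ {p n} → Graph p → Graph n → (Fin p → Fin n) → Set
IsProperSubgraph {p} {n} H' H e =
  Copy H' H e ×
  (p < n ⊎ ∃[ u ] ∃[ v ] (adj H (e u) (e v) ≡ true × adj H' u v ≡ false))

GFreeCritical : ∀ {m n} → Graph m → Graph n → Set
GFreeCritical {m} {n} G H =
  ∃[ k ] IsChiG G H k ×
    (∀ (p : ℕ) (H' : Graph p) (e : Fin p → Fin n) →
       IsProperSubgraph H' H e → HasGFreeColoring G H' (k ∸ 1))

-- Ceiling division ⌈n / d⌉ (for d ≥ 1; defined as 0 when d = 0).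

⌈_/_⌉ : ℕ → ℕ → ℕ
⌈ n / zero ⌉  = 0
⌈ n / suc d ⌉ = (n + d) / suc d

-- Greedy coloring along a degeneracy order.  If every nonempty induced subgraph of
-- H has a vertex of degree < δ(a+1), delete such vertices one by one and color them
-- back in reverse order, each with a color carried by fewer than δ of its neighbors:
-- a monochromatic copy of G through v would give v at least δ(G) ≥ δ neighbors of
-- its own color.  Hence χ_G(H) = a + 1 forces a nonempty induced subgraph of H of
-- minimum degree ≥ δa.  Such subgraphs of H and of its complement, of minimum degrees
-- α and β, satisfy α + β < n (compare degrees at a common vertex, or sizes if they
-- are disjoint).  So if n ≤ δN and χ_G(H) = a + 1, the complement has a G-free
-- (N - a + 1)-coloring, as otherwise δa + δ(N - a + 1) < n ≤ δN.
module Submission where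

open import Defs
open import Data.Bool using (Bool; true; false; not; _∧_; if_then_else_)
open import Data.Bool.Properties using () renaming (_≟_ to _≟ᵇ_)
open import Data.Empty using (⊥; ⊥-elim)
open import Data.Fin using (Fin; zero; suc; _≟_)
open import Data.Fin.Properties using (any?; suc-injective)
open import Data.List using (tabulate)
open import Data.List.Properties using (map-tabulate)
open import Data.Nat using (ℕ; zero; suc; _+_; _*_; _∸_; _≤_; _<_; z≤n; s≤s)
open import Data.Nat.DivMod using (_/_; _%_; m≡m%n+[m/n]*n; m%n<n)
open import Data.Nat.ListAction using (sum)
open import Data.Nat.Properties hiding (_≟_; suc-injective)
open import Algebra.Properties.CommutativeSemigroup +-commutativeSemigroup using (interchange)
open import Data.Product using (Σ; ∃; _×_; _,_; proj₁; proj₂)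
open import Data.Sum using (_⊎_; inj₁; inj₂; [_,_]; map₁)
open import Function using (_∘_; case_of_)
open import Function.Definitions using (Injective)
open import Relation.Binary.PropositionalEquality hiding ([_])
open import Relation.Nullary using (¬_; yes; no; does)
open import Relation.Nullary.Decidable using (_×-dec_; dec-true; dec-false)

private variable
  m n : ℕ

ind : Bool → ℕ
ind b = if b then 1 else 0

count : (Fin n → Bool) → ℕ
count {zero}  P = 0
count {suc n} P = ind (P zero) + count (P ∘ suc)

_⊆_ : (P Q : Fin n → Bool) → Set
P ⊆ Q = ∀ u → P u ≡ true → Q u ≡ true

Disjoint : (P Q : Fin n → Bool) → Set
Disjoint P Q = ∀ u → P u ≡ true → Q u ≡ true → ⊥

-- The conjunct order makes the clauses of count-remove hold definitionally.
_-_ : (Fin n → Bool) → Fin n → Fin n → Bool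
(P - w) u = neq u w ∧ P u

neq-true : {u v : Fin n} → u ≢ v → neq u v ≡ true
neq-true {u = u} {v} u≢v = cong not (dec-false (u ≟ v) u≢v)

neq-irrefl : (v : Fin n) → neq v v ≡ false
neq-irrefl v = cong not (dec-true (v ≟ v) refl)

∧-intro : ∀ {a b} → a ≡ true → b ≡ true → a ∧ b ≡ true
∧-intro refl refl = refl

∧-elimˡ : ∀ {a b} → a ∧ b ≡ true → a ≡ true
∧-elimˡ {true} _ = refl

∧-elimʳ : ∀ {a b} → a ∧ b ≡ true → b ≡ true
∧-elimʳ {true} b≡true = b≡true

not-true : ∀ {b} → b ≡ true → not b ≡ true → ⊥
not-true refl ()

≟-sound : {i j : Fin n} → does (i ≟ j) ≡ true → i ≡ j
≟-sound {i = i} {j} i≟j with i ≟ j | i≟j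
... | yes i≡j | _ = i≡j

count-true : ∀ n → count {n} (λ _ → true) ≡ n
count-true zero    = refl
count-true (suc n) = cong suc (count-true n)

degree≡count : (G : Graph m) (v : Fin m) → degree G v ≡ count (adj G v)
degree≡count G v = trans (cong sum (map-tabulate (λ u → u) (ind ∘ adj G v))) (sum-ind (adj G v))
  where
  sum-ind : (P : Fin n → Bool) → sum (tabulate (ind ∘ P)) ≡ count P
  sum-ind {zero}  P = refl
  sum-ind {suc n} P = cong (ind (P zero) +_) (sum-ind (P ∘ suc))

count-mono : {P Q : Fin n → Bool} → P ⊆ Q → count P ≤ count Q
count-mono {zero}          P⊆Q = z≤n
count-mono {suc n} {P} {Q} P⊆Q = +-mono-≤ (ind-mono (P⊆Q zero)) (count-mono (P⊆Q ∘ suc))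
  where
  ind-mono : ∀ {a b} → (a ≡ true → b ≡ true) → ind a ≤ ind b
  ind-mono {false}     _ = z≤n
  ind-mono {true} a⇒b rewrite a⇒b refl = ≤-refl

count-disjoint : {P Q R : Fin n → Bool} → Disjoint P Q → P ⊆ R → Q ⊆ R →
                 count P + count Q ≤ count R
count-disjoint {zero} _ _ _ = z≤n
count-disjoint {suc n} {P} {Q} {R} P#Q P⊆R Q⊆R =
  subst (_≤ count R) (interchange (ind (P zero)) (ind (Q zero)) (count (P ∘ suc)) (count (Q ∘ suc)))
    (+-mono-≤ (ind-disjoint (P#Q zero) (P⊆R zero) (Q⊆R zero))
              (count-disjoint (P#Q ∘ suc) (P⊆R ∘ suc) (Q⊆R ∘ suc)))
  where
  ind-disjoint : ∀ {a b c} → (a ≡ true → b ≡ true → ⊥) → (a ≡ true → c ≡ true) →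
                 (b ≡ true → c ≡ true) → ind a + ind b ≤ ind c
  ind-disjoint {false} {false} _ _ _ = z≤n
  ind-disjoint {false} {true} _ _ b⇒c rewrite b⇒c refl = ≤-refl
  ind-disjoint {true} {false} _ a⇒c _ rewrite a⇒c refl = ≤-refl
  ind-disjoint {true} {true} a#b _ _ = ⊥-elim (a#b refl refl)

count-remove : (P : Fin n → Bool) {w : Fin n} → P w ≡ true → count P ≡ suc (count (P - w))
count-remove P {zero} Pw rewrite Pw = refl
count-remove P {suc w} Pw =
  trans (cong (ind (P zero) +_) (count-remove (P ∘ suc) Pw)) (+-suc (ind (P zero)) _)

count-injective : {P : Fin m → Bool} {Q : Fin n → Bool} (f : Fin m → Fin n) →
                  Injective _≡_ _≡_ f → (∀ y → P y ≡ true → Q (f y) ≡ true) →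
                  count P ≤ count Q
count-injective {zero} f _ _ = z≤n
count-injective {suc m} {P = P} {Q = Q} f f-inj maps with P zero in P₀
... | false = count-injective (f ∘ suc) (suc-injective ∘ f-inj) (maps ∘ suc)
... | true  = subst (suc (count (P ∘ suc)) ≤_) (sym (count-remove Q (maps zero P₀)))
                (s≤s (count-injective (f ∘ suc) (suc-injective ∘ f-inj) maps-off-f₀))
  where
  maps-off-f₀ : ∀ y → P (suc y) ≡ true → (Q - f zero) (f (suc y)) ≡ true
  maps-off-f₀ y Py = ∧-intro (neq-true (λ eq → case f-inj eq of λ ())) (maps (suc y) Py)

colorClass : ∀ {k} → (Fin n → Bool) → (Fin n → Fin k) → Fin k → Fin n → Bool
colorClass P c i u = P u ∧ does (c u ≟ i)

pigeonhole : (δ a : ℕ) (c : Fin n → Fin (suc a)) (P : Fin n → Bool) →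
             count P < δ * suc a → ∃ λ i → count (colorClass P c i) < δ
pigeonhole δ zero c P P<δ =
  zero , ≤-<-trans (count-mono {Q = P} (λ u → ∧-elimˡ {P u})) (subst (count P <_) (*-identityʳ δ) P<δ)
pigeonhole {n} δ (suc a) c P P<δ[2+a] with count (colorClass P c zero) <? δ
... | yes class₀<δ = zero , class₀<δ
... | no  class₀≮δ = suc i , ≤-<-trans (count-mono shift) class<δ
  where
  -- color 0 is sent to the junk value 0; it does not occur in P′
  lower : Fin (suc (suc a)) → Fin (suc a)
  lower zero    = zero
  lower (suc j) = j

  P′ : Fin n → Bool
  P′ u = P u ∧ not (does (c u ≟ zero))

  split : count (colorClass P c zero) + count P′ ≤ count P
  split = count-disjoint (λ u in₀ out₀ → not-true (∧-elimʳ {P u} in₀) (∧-elimʳ {P u} out₀))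
                         (λ u → ∧-elimˡ {P u}) (λ u → ∧-elimˡ {P u})

  P′<δ[1+a] : count P′ < δ * suc a
  P′<δ[1+a] = +-cancelˡ-< δ _ _ (begin-strict
    δ + count P′                           ≤⟨ +-monoˡ-≤ (count P′) (≮⇒≥ class₀≮δ) ⟩
    count (colorClass P c zero) + count P′ ≤⟨ split ⟩
    count P                                <⟨ P<δ[2+a] ⟩
    δ * suc (suc a)                        ≡⟨ *-suc δ (suc a) ⟩
    δ + δ * suc a                          ∎)
    where open ≤-Reasoning

  small-class : ∃ λ i → count (colorClass P′ (lower ∘ c) i) < δ
  small-class = pigeonhole δ a (lower ∘ c) P′ P′<δ[1+a]

  i : Fin (suc a)
  i = proj₁ small-class

  class<δ : count (colorClass P′ (lower ∘ c) i) < δ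
  class<δ = proj₂ small-class

  shift : colorClass P c (suc i) ⊆ colorClass P′ (lower ∘ c) i
  shift u in-suc-i with c u | ≟-sound {i = c u} {suc i} (∧-elimʳ in-suc-i)
  ... | _ | refl = ∧-intro (∧-intro (∧-elimˡ in-suc-i) refl) (dec-true (i ≟ i) refl)

adj⇒neq : (H : Graph n) {u v : Fin n} → adj H v u ≡ true → neq u v ≡ true
adj⇒neq H {u} {v} vu = neq-true {u = u} {v} λ { refl → case trans (sym (adj-irrefl H v)) vu of λ () }

degreeIn : Graph n → (Fin n → Bool) → Fin n → ℕ
degreeIn H S v = count (λ u → S u ∧ adj H v u)

Core : Graph n → ℕ → Set
Core {n} H α = Σ (Fin n → Bool) λ S →
  (∃ λ v → S v ≡ true) × (∀ v → S v ≡ true → α ≤ degreeIn H S v)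

core-zero : {H : Graph n} → Fin n → Core H 0
core-zero v = (λ _ → true) , (v , refl) , λ _ _ → z≤n

degreeIn<count : (H : Graph n) (S : Fin n → Bool) {v : Fin n} → S v ≡ true →
                 degreeIn H S v < count S
degreeIn<count H S {v} Sv = subst (degreeIn H S v <_) (sym (count-remove S Sv))
  (s≤s (count-mono λ u Svu → ∧-intro (adj⇒neq H (∧-elimʳ {S u} Svu)) (∧-elimˡ {S u} Svu)))

core-complement-bound : (H : Graph n) {α β : ℕ} → Core H α → Core (complement H) β → α + β < n
core-complement-bound {n} H {α} {β} (S , (v , Sv) , S-deg) (T , (w , Tw) , T-deg)
  with any? (λ u → (S u ≟ᵇ true) ×-dec (T u ≟ᵇ true))
... | yes (u , Su , Tu) = begin-strict
  α + β                                         ≤⟨ +-mono-≤ (S-deg u Su) (T-deg u Tu) ⟩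
  degreeIn H S u + degreeIn (complement H) T u  ≤⟨ count-disjoint separated S-nbr-≢u T-nbr-≢u ⟩
  count ((λ _ → true) - u)                      <⟨ ≤-reflexive (sym (count-remove {n} (λ _ → true) {u} refl)) ⟩
  count {n} (λ _ → true)                        ≡⟨ count-true n ⟩
  n                                             ∎
  where
  open ≤-Reasoning
  separated : Disjoint (λ x → S x ∧ adj H u x) (λ x → T x ∧ adj (complement H) u x)
  separated x in-S in-T =
    not-true (∧-elimʳ {S x} in-S) (∧-elimˡ {not (adj H u x)} (∧-elimʳ {T x} in-T))
  S-nbr-≢u : (λ x → S x ∧ adj H u x) ⊆ ((λ _ → true) - u)
  S-nbr-≢u x in-S = ∧-intro (adj⇒neq H (∧-elimʳ {S x} in-S)) refl
  T-nbr-≢u : (λ x → T x ∧ adj (complement H) u x) ⊆ ((λ _ → true) - u)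
  T-nbr-≢u x in-T = ∧-intro (adj⇒neq (complement H) (∧-elimʳ {T x} in-T)) refl
... | no no-common = begin-strict
  α + β                ≤⟨ +-monoʳ-≤ α (n≤1+n β) ⟩
  α + suc β            <⟨ +-mono-≤ (<-≤-trans (s≤s (S-deg v Sv)) (degreeIn<count H S Sv))
                                   (<-≤-trans (s≤s (T-deg w Tw)) (degreeIn<count (complement H) T Tw)) ⟩
  count S + count T    ≤⟨ count-disjoint (λ x Sx Tx → no-common (x , Sx , Tx)) (λ _ _ → refl) (λ _ _ → refl) ⟩
  count {n} (λ _ → true) ≡⟨ count-true n ⟩
  n                    ∎
  where open ≤-Reasoning

core-size : (H : Graph n) {α : ℕ} → Core H α → α < n
core-size H core@(_ , (v , _) , _) =
  subst (_< _) (+-identityʳ _) (core-complement-bound H core (core-zero {H = complement H} v))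

recolor : ∀ {k} → (Fin n → Fin k) → Fin n → Fin k → Fin n → Fin k
recolor π v i u = if neq u v then π u else i

recolor-off : ∀ {k} (π : Fin n → Fin k) {u v : Fin n} {i : Fin k} →
              neq u v ≡ true → recolor π v i u ≡ π u
recolor-off π u≢v rewrite u≢v = refl

recolor-at : ∀ {k} (π : Fin n → Fin k) (v : Fin n) (i : Fin k) → recolor π v i v ≡ i
recolor-at π v i rewrite neq-irrefl v = refl

IsGFreeColoringOn : Graph m → (H : Graph n) → (Fin n → Bool) → (k : ℕ) → (Fin n → Fin k) → Set
IsGFreeColoringOn G H S k π =
  ∀ i f → Copy G H f → (∀ x → S (f x) ≡ true) → ¬ (∀ x → π (f x) ≡ i)

module GreedyColoring (G : Graph m) (x₀ : Fin m) (δ : ℕ) (δ≤degree : ∀ x → δ ≤ degree G x) where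

  coloring-on-empty : {H : Graph n} {S : Fin n → Bool} {k : ℕ} {π : Fin n → Fin k} →
                      (∀ v → S v ≡ true → ⊥) → IsGFreeColoringOn G H S k π
  coloring-on-empty S-empty _ f _ inS _ = S-empty (f x₀) (inS x₀)

  δ≤count-copy-nbrs : {H : Graph n} {f : Fin m → Fin n} {x : Fin m} {P : Fin n → Bool} →
                      Copy G H f → (∀ y → adj G x y ≡ true → P (f y) ≡ true) → δ ≤ count P
  δ≤count-copy-nbrs {f = f} {x} {P} (f-inj , _) nbrs-in-P = begin
    δ                ≤⟨ δ≤degree x ⟩
    degree G x       ≡⟨ degree≡count G x ⟩
    count (adj G x)  ≤⟨ count-injective f f-inj nbrs-in-P ⟩
    count P          ∎
    where open ≤-Reasoning

  extend-coloring : (H : Graph n) (a : ℕ) (S : Fin n → Bool) {v : Fin n} → S v ≡ true →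
                    degreeIn H S v < δ * suc a → (π : Fin n → Fin (suc a)) →
                    IsGFreeColoringOn G H (S - v) (suc a) π → ∃ (IsGFreeColoringOn G H S (suc a))
  extend-coloring {n} H a S {v} Sv low π π-free = π′ , π′-free
    where
    nbrs : Fin n → Bool
    nbrs u = (S - v) u ∧ adj H v u

    few-nbrs-of-one-color : ∃ λ i → count (colorClass nbrs π i) < δ
    few-nbrs-of-one-color = pigeonhole δ a π nbrs (≤-<-trans (count-mono nbrs⊆) low)
      where
      nbrs⊆ : nbrs ⊆ (λ u → S u ∧ adj H v u)
      nbrs⊆ u h = ∧-intro (∧-elimʳ {neq u v} (∧-elimˡ {(S - v) u} h)) (∧-elimʳ {(S - v) u} h)

    i : Fin (suc a)
    i = proj₁ few-nbrs-of-one-color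

    π′ : Fin n → Fin (suc a)
    π′ = recolor π v i

    π′-free : IsGFreeColoringOn G H S (suc a) π′
    π′-free j f copy inS mono with any? (λ x → f x ≟ v)
    ... | no avoids-v = π-free j f copy (λ x → ∧-intro (off-v x) (inS x))
                                        (λ x → trans (sym (recolor-off π (off-v x))) (mono x))
      where
      off-v : ∀ x → neq (f x) v ≡ true
      off-v x = neq-true (λ fx≡v → avoids-v (x , fx≡v))
    ... | yes (x₁ , fx₁≡v) = <⇒≱ (proj₂ few-nbrs-of-one-color) (δ≤count-copy-nbrs {H = H} copy nbr-of-color-i)
      where
      nbr-of-color-i : ∀ y → adj G x₁ y ≡ true → colorClass nbrs π i (f y) ≡ true
      nbr-of-color-i y x₁~y =
        ∧-intro (∧-intro (∧-intro fy≢v (inS y)) v~fy) (dec-true (π (f y) ≟ i) fy-color)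
        where
        v~fy : adj H v (f y) ≡ true
        v~fy = subst (λ w → adj H w (f y) ≡ true) fx₁≡v (proj₂ copy x₁ y x₁~y)
        fy≢v : neq (f y) v ≡ true
        fy≢v = adj⇒neq H v~fy
        fy-color : π (f y) ≡ i
        fy-color = begin
          π (f y)   ≡⟨ recolor-off π fy≢v ⟨
          π′ (f y)  ≡⟨ mono y ⟩
          j         ≡⟨ mono x₁ ⟨
          π′ (f x₁) ≡⟨ cong π′ fx₁≡v ⟩
          π′ v      ≡⟨ recolor-at π v i ⟩
          i         ∎
          where open ≡-Reasoning


  coloring-or-core-on : (H : Graph n) (a k : ℕ) (S : Fin n → Bool) → count S ≤ k →
                        ∃ (IsGFreeColoringOn G H S (suc a)) ⊎ Core H (δ * suc a)
  coloring-or-core-on H a zero S S≤0 = inj₁ ((λ _ → zero) , coloring-on-empty {H = H} S-empty)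
    where
    S-empty : ∀ v → S v ≡ true → ⊥
    S-empty v Sv = <⇒≱ (subst (0 <_) (sym (count-remove S Sv)) (s≤s z≤n)) S≤0
  coloring-or-core-on H a (suc k) S S≤1+k
    with any? (λ v → (S v ≟ᵇ true) ×-dec (degreeIn H S v <? δ * suc a))
  ... | yes (v , Sv , low) =
    map₁ (λ (π , π-free) → extend-coloring H a S Sv low π π-free)
                  (coloring-or-core-on H a k (S - v) (≤-pred (subst (_≤ suc k) (count-remove S Sv) S≤1+k)))
  ... | no no-low with any? (λ v → S v ≟ᵇ true)
  ...   | yes (v , Sv) = inj₂ (S , (v , Sv) , λ w Sw → ≮⇒≥ (λ low → no-low (w , Sw , low)))
  ...   | no S-empty   = inj₁ ((λ _ → zero) , coloring-on-empty {H = H} (λ v Sv → S-empty (v , Sv)))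

  coloring-or-core : (H : Graph n) (a : ℕ) → HasGFreeColoring G H (suc a) ⊎ Core H (δ * suc a)
  coloring-or-core {n} H a =
    map₁ (λ (π , π-free) → π , λ i f copy → π-free i f copy (λ _ → refl))
                  (coloring-or-core-on H a n (λ _ → true) (≤-reflexive (count-true n)))

  chi-core : (H : Graph n) → Fin n → {a : ℕ} → IsChiG G H (suc a) → Core H (δ * a)
  chi-core H v {zero} _ = subst (Core H) (sym (*-zeroʳ δ)) (core-zero {H = H} v)
  chi-core H v {suc a} (_ , minimal) with coloring-or-core H a
  ... | inj₁ coloring = ⊥-elim (1+n≰n (minimal (suc a) coloring))
  ... | inj₂ core     = core

  chi-sum-bound : (H : Graph (suc n)) {N k₁ k₂ : ℕ} → suc n ≤ δ * N →
                  IsChiG G H k₁ → IsChiG G (complement H) k₂ → k₁ + k₂ ≤ N + 2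
  chi-sum-bound H {k₁ = zero} _ ((π , _) , _) _ = case π zero of λ ()
  chi-sum-bound {n} H {N} {suc a} {k₂} n≤δN χ₁ (_ , minimal₂) =
    [ sum-bound , ⊥-elim ∘ no-core ] (coloring-or-core (complement H) (N ∸ a))
    where
    open ≤-Reasoning

    core₁ : Core H (δ * a)
    core₁ = chi-core H zero χ₁

    a+[1+N∸a]≡1+N : a + suc (N ∸ a) ≡ suc N
    a+[1+N∸a]≡1+N = trans (+-suc a (N ∸ a)) (cong suc (m+[n∸m]≡n (<⇒≤ a<N)))
      where
      a<N : a < N
      a<N = *-cancelˡ-< δ a N (<-≤-trans (core-size H core₁) n≤δN)

    sum-bound : HasGFreeColoring G (complement H) (suc (N ∸ a)) → suc a + k₂ ≤ N + 2
    sum-bound coloring = begin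
      suc a + k₂           ≤⟨ +-monoʳ-≤ (suc a) (minimal₂ _ coloring) ⟩
      suc a + suc (N ∸ a)  ≡⟨ cong suc a+[1+N∸a]≡1+N ⟩
      suc (suc N)          ≡⟨ +-comm 2 N ⟩
      N + 2                ∎

    no-core : ¬ Core (complement H) (δ * suc (N ∸ a))
    no-core core₂ = <⇒≱ (core-complement-bound H core₁ core₂) (begin
      suc n                    ≤⟨ n≤δN ⟩
      δ * N                    ≤⟨ m≤n+m _ δ ⟩
      δ + δ * N                ≡⟨ *-suc δ N ⟨
      δ * suc N                ≡⟨ cong (δ *_) a+[1+N∸a]≡1+N ⟨
      δ * (a + suc (N ∸ a))    ≡⟨ *-distribˡ-+ δ a (suc (N ∸ a)) ⟩
      δ * a + δ * suc (N ∸ a)  ∎)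

n≤δ*⌈n/δ⌉ : ∀ n d → n ≤ suc d * ⌈ n / suc d ⌉
n≤δ*⌈n/δ⌉ n d = +-cancelˡ-≤ d n _ (begin
  d + n                                      ≡⟨ +-comm d n ⟩
  n + d                                      ≡⟨ m≡m%n+[m/n]*n (n + d) (suc d) ⟩
  (n + d) % suc d + (n + d) / suc d * suc d  ≤⟨ +-monoˡ-≤ _ (≤-pred (m%n<n (n + d) (suc d))) ⟩
  d + (n + d) / suc d * suc d                ≡⟨ cong (d +_) (*-comm _ (suc d)) ⟩
  d + suc d * ((n + d) / suc d)              ∎)
  where open ≤-Reasoning

lemma4 : ∀ {m n} (G : Graph m) (H : Graph n) (δ : ℕ) →
    IsMinDegree G δ → 1 ≤ δ →
    ¬ (G ≅ complete (δ + 1)) →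
    ¬ GFreeCritical G H →
    ∀ (k₁ k₂ : ℕ) → IsChiG G H k₁ → IsChiG G (complement H) k₂ →
    k₁ + k₂ ≤ ⌈ n / δ ⌉ + 2
lemma4 G H zero _ ()
lemma4 {n = zero} G H _ _ _ _ _ _ _ (_ , minimal₁) (_ , minimal₂) =
  ≤-trans (+-mono-≤ (minimal₁ 0 (no-colors H)) (minimal₂ 0 (no-colors (complement H)))) z≤n
  where
  no-colors : (K : Graph 0) → HasGFreeColoring G K 0
  no-colors _ = (λ ()) , λ ()
lemma4 {n = suc n} G H δ@(suc d) ((x₀ , _) , δ≤degree) _ _ _ _ _ =
  chi-sum-bound H (n≤δ*⌈n/δ⌉ (suc n) d)
  where open GreedyColoring G x₀ δ δ≤degree
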